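{- There is a retraction $\phi:\mathcal{U}_0^{\mathrm{cpr}}\to\mathcal{U}_0^{\mathrm{pr}}$ (i.e. $\phi$ has a section) which forgets the context $\Gamma$ and preserves the base type $X$.
   Context: $\mathcal R=\mathrm{Sh}(\mathrm{R},\mathrm{J}_{\mathrm{fin}})$, where $\mathrm{R}$ has objects $\mathbf 1$ (terminal) and $\mathbf N$, $\mathrm{R}(\mathbf N,\mathbf N)$ = primitive recursive functions $\mathbb N\to\mathbb N$, $\mathrm{R}(\mathbf 1,\mathbf N)=\mathbb N$, and $\mathrm{J}_{\mathrm{fin}}$ is generated by finite jointly surjective families. $\mathbf y_{\mathbf N}$ is the representable sheaf with $\mathsf z=0$ and successor $\mathsf s$; $\mathcal U_0<\mathcal U_1$ are strong cumulative universes in $\mathcal R$. In the internal language: $\mathrm{comp}(f,g,h):=(f(\mathsf z)=g)\times\big((n:\mathbf y_{\mathbf N})\to f(\mathsf s n)=h(n,fn)\big)$; $\mathcal U_0^{\mathrm{pr}}:=(X:\mathcal U_0)\times\big((g:X)\to(h:\mathbf y_{\mathbf N}\to X\to X)\to (f:\mathbf y_{\mathbf N}\to X)\times\mathrm{comp}(f,g,h)\big)$; $\mathcal U_0^{\mathrm{cpr}}:=(X:\mathcal U_0)\times\big((\Gamma:\mathcal U_0)\to(g:\Gamma\to X)\to(h:\Gamma\to\mathbf y_{\mathbf N}\to X\to X)\to (f:\Gamma\to\mathbf y_{\mathbf N}\to X)\times((\gamma:\Gamma)\to\mathrm{comp}(f^\gamma,g^\gamma,h^\gamma))\big)$, where $f^\gamma,g^\gamma,h^\gamma$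 denote application to $\gamma$. -}

module Defs where

open import Data.Product using (Σ; _×_; _,_; proj₁; proj₂)
open import Relation.Binary.PropositionalEquality using (_≡_)

-- Internal language of R, rendered in Agda's own type theory:
-- U₀ is Set, U₁ is Set₁, the identity type is _≡_, and y_N is an
-- arbitrary type N with z : N and s : N → N (module parameters).
module _ (N : Set) (z : N) (s : N → N) where

  comp : {X : Set} → (N → X) → X → (N → X → X) → Set
  comp f g h = (f z ≡ g) × ((n : N) → f (s n) ≡ h n (f n))

  PrStr : Set → Set
  PrStr X = (g : X) → (h : N → X → X) → Σ (N → X) λ f → comp f g h

  CprStr : Set → Set₁
  CprStr X = (Γ : Set) → (g : Γ → X) → (h : Γ → N → X → X)
           → Σ (Γ → N → X) λ f → ((γ : Γ) → comp (f γ) (g γ) (h γ))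

  Upr : Set₁
  Upr = Σ Set PrStr

  Ucpr : Set₁
  Ucpr = Σ Set CprStr

  overX : ((X : Set) → CprStr X → PrStr X) → Ucpr → Upr
  overX r (X , c) = X , r X c

{-# OPTIONS --safe #-}
module Submission where

open import Defs
open import Data.Product using (Σ; _×_; _,_; proj₁; proj₂; map; map₂)
open import Data.Unit using (⊤; tt)
open import Relation.Binary.PropositionalEquality using (_≡_; refl)

module _ {N : Set} {z : N} {s : N → N} where

  forgetContext : {X : Set} → CprStr N z s X → PrStr N z s X
  forgetContext c g h =
    map (λ f → f tt) (λ computes → computes tt) (c ⊤ (λ _ → g) (λ _ → h))

  recursePointwise : {X : Set} → PrStr N z s X → CprStr N z s X
  recursePointwise p Γ g h =
    (λ γ → proj₁ (p (g γ) (h γ))) , (λ γ → proj₂ (p (g γ) (h γ)))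

  -- Holds definitionally thanks to η for Σ and Π; no function extensionality is needed.
  forgetContext-recursePointwise : (P : Upr N z s) →
    overX N z s (λ _ → forgetContext) (map₂ recursePointwise P) ≡ P
  forgetContext-recursePointwise _ = refl

mainTheorem10 : (N : Set) (z : N) (s : N → N)
    → Σ ((X : Set) → CprStr N z s X → PrStr N z s X) λ r
    → Σ (Upr N z s → Ucpr N z s) λ σ
    → ((p : Upr N z s) → overX N z s r (σ p) ≡ p)
      × ((X : Set) (c : CprStr N z s X) (g : X) (h : N → X → X) (n : N)
         → proj₁ (r X c g h) n ≡ proj₁ (c ⊤ (λ _ → g) (λ _ → h)) tt n)
mainTheorem10 N z s =
    (λ _ → forgetContext)
  , map₂ recursePointwise
  , forgetContext-recursePointwise
  , (λ _ _ _ _ _ → refl)
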